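{- Let $\mathcal{T}=(S,S_0,\varrho,L)$ be a finite transition system and let $\varphi=\forall\pi_1\ldots\forall\pi_k.\exists\pi_{k+1}\ldots\exists\pi_{k+l}.\,\phi$ be a HyperLTL formula with quantifier-free (LTL) matrix $\phi$. If the verifier $\mathfrak{V}$ wins the parity game $\mathcal{G}(\mathcal{T},\varphi)$ from every node in $V_{\mathit{init}}=\{(s_1,\ldots,s_k)\mid s_i\in S_0 \text{ for all } 1\le i\le k\}$, then $\mathcal{T}\models\varphi$.
   Context: Fix a finite set $\mathit{AP}$ of atomic propositions and $\Sigma=2^{\mathit{AP}}$; a trace is an element of $\Sigma^\omega$. For traces $t_1,\ldots,t_n$, $\mathrm{zip}(t_1,\ldots,t_n)\in(\Sigma^n)^\omega$ is the pointwise tuple. A transition system $\mathcal{T}=(S,S_0,\varrho,L)$ has a finite state set $S$, initial states $S_0\subseteq S$, transition relation $\varrho\subseteq S\times S$ such that every state has at least one successor, and labelling $L:S\to\Sigma$; a path is an infinite state sequence starting in $S_0$ following $\varrho$, and $\mathit{Traces}(\mathcal{T})$ is the set of label sequences of paths. HyperLTL formulas are $\varphi ::= \exists\pi.\varphi\mid\forall\pi.\varphi\mid\phi$ with $\phi ::= a_\pi\mid\neg\phi\mid\phi\wedge\phi\mid \mathsf{X}\phi\mid\phi\,\mathsf{U}\,\phi$ (standard LTL semantics over a trace assignment $\Pi$, with $a_\pi$ true at position $i$ iff $a\in\Pi(\pi)(i)$); trace quantifiers range over $\mathit{Traces}(\mathcal{T})$, and $\mathcal{T}\models\varphi$ means the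 closed formula holds from the empty assignment. The game $\mathcal{G}(\mathcal{T},\varphi)$: let $\mathcal{A}^\phi=(Q^\phi,q^\phi_0,\delta^\phi,c^\phi)$ be a deterministic parity automaton over $\Sigma^{k+l}$ accepting $\mathrm{zip}(t_1,\ldots,t_{k+l})$ iff $[\pi_i\mapsto t_i]_i\models\phi$. Nodes are tuples $(s_1,\ldots,s_k)\in S^k$ (verifier nodes) and triples $\langle(s_1,\ldots,s_{k+l}),q,\flat\rangle$ with $s_i\in S$, $q\in Q^\phi$, $\flat\in\{\forall,\exists\}$, owned by the refuter if $\flat=\forall$ and by the verifier if $\flat=\exists$. Moves: from $(s_1,\ldots,s_k)$ to $\langle(s_1,\ldots,s_k,s_{k+1},\ldots,s_{k+l}),q^\phi_0,\forall\rangle$ for any $s_{k+1},\ldots,s_{k+l}\in S_0$; from $\langle(s_1,\ldots,s_{k+l}),q,\forall\rangle$ to $\langle(s_1',\ldots,s_k',s_{k+1},\ldots,s_{k+l}),q',\exists\rangle$ where $(s_i,s_i')\in\varrho$ for $i\le k$ and $q'=\delta^\phi(q,(L(s_1),\ldots,L(s_{k+l})))$; from $\langle(s_1,\ldots,s_{k+l}),q,\exists\rangle$ to $\langle(s_1,\ldots,s_k,s'_{k+1},\ldots,s'_{k+l}),q,\forall\rangle$ where $(s_i,s_i')\in\varrho$ for $i>k$. A triple node has colour $c^\phi(q)$; an infinite play is won by the verifier iff the minimal colour occurring infinitely often is even. -}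

module Defs where

open import Level using (0ℓ)
open import Data.Nat using (ℕ; zero; suc; _≤_; _<_)
open import Data.Nat.Divisibility using (_∣_)
open import Data.Fin using (Fin)
open import Data.Fin.Subset using (Subset; _∈_)
open import Data.Vec using (Vec; tabulate; map; _++_; lookup)
open import Data.Vec.Relation.Unary.All using (All)
open import Data.Vec.Relation.Binary.Pointwise.Inductive using (Pointwise)
open import Data.Vec.Functional as VF using (Vector)
open import Data.List using (List)
import Data.List as List
open import Data.Product using (Σ; ∃; _×_; proj₁)
open import Data.Empty using (⊥)
open import Relation.Binary.PropositionalEquality using (_≡_)
open import Relation.Nullary using (¬_)

-- Atomic propositions AP = Fin a, letters Σ = 2^AP = Subset a,
-- traces are infinite sequences of letters.

Letter : ℕ → Set
Letter a = Subset a

Trace : ℕ → Set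
Trace a = ℕ → Letter a

zipT : ∀ {a m} → (Fin m → Trace a) → ℕ → Vec (Letter a) m
zipT ts i = tabulate (λ j → ts j i)

InfOften : (ℕ → ℕ) → ℕ → Set
InfOften col c = ∀ i → ∃ λ j → i ≤ j × col j ≡ c

ParityWin : (ℕ → ℕ) → Set
ParityWin col = ∃ λ c → 2 ∣ c × InfOften col c × (∀ c' → c' < c → ¬ InfOften col c')

record TS (a : ℕ) : Set₁ where
  field
    n     : ℕ
    S₀    : Fin n → Set
    ϱ     : Fin n → Fin n → Set
    total : ∀ s → ∃ λ s' → ϱ s s'
    L     : Fin n → Letter a

  State : Set
  State = Fin n

  IsPath : (ℕ → State) → Set
  IsPath p = S₀ (p 0) × (∀ i → ϱ (p i) (p (suc i)))

  IsTrace : Trace a → Set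
  IsTrace t = ∃ λ (p : ℕ → State) → IsPath p × (∀ i → t i ≡ L (p i))

data LTL (a m : ℕ) : Set where
  atom  : Fin a → Fin m → LTL a m
  ¬'_   : LTL a m → LTL a m
  _∧'_  : LTL a m → LTL a m → LTL a m
  X'    : LTL a m → LTL a m
  _U'_  : LTL a m → LTL a m → LTL a m

Sat : ∀ {a m} → LTL a m → (Fin m → Trace a) → ℕ → Set
Sat (atom x π) Π i = x ∈ Π π i
Sat (¬' φ)     Π i = ¬ Sat φ Π i
Sat (φ ∧' ψ)   Π i = Sat φ Π i × Sat ψ Π i
Sat (X' φ)     Π i = Sat φ Π (suc i)
Sat (φ U' ψ)   Π i = ∃ λ j → i ≤ j × Sat ψ Π j × (∀ m → i ≤ m → m < j → Sat φ Π m)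

-- T ⊨ ∀π_1…∀π_k.∃π_{k+1}…∃π_{k+l}. φ   (semantics unfolded; the
-- assignment maps π_1..π_k to the first k indices, the rest after).
Models : ∀ {a} → TS a → (k l : ℕ) → LTL a (k Data.Nat.+ l) → Set
Models T k l φ =
  (us : Fin k → Trace _) → (∀ i → TS.IsTrace T (us i)) →
  ∃ λ (es : Fin l → Trace _) → (∀ j → TS.IsTrace T (es j)) ×
    Sat φ (us VF.++ es) 0

record DPA (A : Set) : Set where
  field
    nQ : ℕ
    q₀ : Fin nQ
    δ  : Fin nQ → A → Fin nQ
    c  : Fin nQ → ℕ

  run : (ℕ → A) → ℕ → Fin nQ
  run w zero    = q₀
  run w (suc i) = δ (run w i) (w i)

  Accepts : (ℕ → A) → Set
  Accepts w = ParityWin (λ i → c (run w i))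

data Flat : Set where
  ∀♭ ∃♭ : Flat

data Player : Set where
  verifier refuter : Player

module Game {a} (T : TS a) (k l : ℕ) (𝔸 : DPA (Vec (Letter a) (k Data.Nat.+ l))) where
  open TS T
  open DPA 𝔸

  data Node : Set where
    vnode : Vec State k → Node
    tnode : Vec State k → Vec State l → Fin nQ → Flat → Node

  owner : Node → Player
  owner (vnode _)         = verifier
  owner (tnode _ _ _ ∀♭)  = refuter
  owner (tnode _ _ _ ∃♭)  = verifier

  -- Colour of triple nodes is c(q).  Verifier nodes have no incoming
  -- moves, so they occur at most at position 0 of a play; their colour
  -- (fixed to 0 here) does not affect the winner.
  colour : Node → ℕ
  colour (vnode _)       = 0
  colour (tnode _ _ q _) = c q

  data Move : Node → Node → Set where
    init : ∀ ss (es : Vec State l) → All S₀ es →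
           Move (vnode ss) (tnode ss es q₀ ∀♭)
    univ : ∀ ss ss' es q → Pointwise ϱ ss ss' →
           Move (tnode ss es q ∀♭) (tnode ss' es (δ q (map L (ss ++ es))) ∃♭)
    exis : ∀ ss es es' q → Pointwise ϱ es es' →
           Move (tnode ss es q ∃♭) (tnode ss es' q ∀♭)

  Strategy : Set
  Strategy = (h : List Node) (v : Node) → owner v ≡ verifier → Σ Node (Move v)

  IsPlay : Node → (ℕ → Node) → Set
  IsPlay v p = p 0 ≡ v × (∀ i → Move (p i) (p (suc i)))

  history : (ℕ → Node) → ℕ → List Node
  history p i = List.tabulate {n = i} (λ j → p (Data.Fin.toℕ j))

  ConsistentWith : Strategy → (ℕ → Node) → Set
  ConsistentWith σ p = ∀ i (o : owner (p i) ≡ verifier) →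
                       p (suc i) ≡ proj₁ (σ (history p i) (p i) o)

  -- The verifier wins from v: some strategy wins every consistent play
  -- (refuter is never stuck since ϱ is total; the strategy always supplies
  -- a legal verifier move).
  VerifierWins : Node → Set
  VerifierWins v = ∃ λ (σ : Strategy) →
    ∀ p → IsPlay v p → ConsistentWith σ p → ParityWin (λ i → colour (p i))

{-# OPTIONS --safe #-}
module Submission where

-- Let the refuter move the universal components along the paths of the given
-- universal traces and let the verifier answer with its winning strategy σ.
-- The existential components chosen by σ then trace out paths of T, and the
-- automaton component of the play is the run of 𝔸 on the zipped traces, each
-- automaton state being shown twice (at a ∀-node and at the ∃-node after it).
-- So the colours of the play are those of the run at half speed, the verifier
-- winning the play means that 𝔸 accepts, and 𝔸 accepts exactly when φ holds.

open import Defs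
open import Data.Nat using (ℕ; zero; suc; _+_; _≤_; z≤n; s≤s; ⌈_/2⌉)
open import Data.Nat.Properties using (≤-trans; m≤n⇒m≤1+n; ⌈n/2⌉-mono)
open import Data.Fin using (Fin; toℕ; splitAt)
import Data.Fin as Fin
open import Data.Vec using (Vec; _∷_; tabulate; map; _++_; lookup)
open import Data.Vec.Properties using (tabulate-cong; tabulate-∘; tabulate∘lookup; map-++)
open import Data.Vec.Relation.Unary.All using (All)
import Data.Vec.Relation.Unary.All.Properties as All
open import Data.Vec.Relation.Binary.Pointwise.Inductive using (Pointwise)
import Data.Vec.Relation.Binary.Pointwise.Inductive as Pointwise
import Data.Vec.Functional as VF
open import Data.List using (List; []; _∷_; _∷ʳ_)
import Data.List as List
open import Data.Product using (Σ; ∃; _×_; _,_; proj₁; proj₂)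
open import Data.Sum.Properties using ([,]-map)
open import Data.Empty using (⊥; ⊥-elim)
open import Relation.Binary.PropositionalEquality
open import Function using (_∘_)
open import Function.Bundles using (_⇔_; mk⇔; Equivalence)

double : ℕ → ℕ
double zero    = zero
double (suc n) = suc (suc (double n))

n≤double : ∀ n → n ≤ double n
n≤double zero    = z≤n
n≤double (suc n) = s≤s (m≤n⇒m≤1+n (n≤double n))

⌈double/2⌉ : ∀ n → ⌈ double n /2⌉ ≡ n
⌈double/2⌉ zero    = refl
⌈double/2⌉ (suc n) = cong suc (⌈double/2⌉ n)

data Parity : ℕ → Set where
  even : ∀ t → Parity (double t)
  odd  : ∀ t → Parity (suc (double t))

parity : ∀ n → Parity n
parity zero = even zero
parity (suc n) with parity n
... | even t = odd t
... | odd t  = even (suc t)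

ParityWin-cong : ∀ {f g : ℕ → ℕ} → (∀ c → InfOften f c ⇔ InfOften g c) →
                 ParityWin f → ParityWin g
ParityWin-cong f⇔g (c , 2∣c , f-inf , f-min) =
  c , 2∣c , Equivalence.to (f⇔g c) f-inf ,
  λ c' c'<c g-inf → f-min c' c'<c (Equivalence.from (f⇔g c') g-inf)

InfOften-stutter : ∀ {f g : ℕ → ℕ} {c} → (∀ i → g (suc i) ≡ f ⌈ i /2⌉) →
                   InfOften g c ⇔ InfOften f c
InfOften-stutter {f} {g} {c} g≡f = mk⇔ to from
  where
  to : InfOften g c → InfOften f c
  to g-inf i with g-inf (suc (double i))
  ... | suc j , s≤s 2i≤j , gj≡c =
    ⌈ j /2⌉ , subst (_≤ ⌈ j /2⌉) (⌈double/2⌉ i) (⌈n/2⌉-mono 2i≤j) , trans (sym (g≡f j)) gj≡c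

  from : InfOften f c → InfOften g c
  from f-inf i with f-inf i
  ... | t , i≤t , ft≡c =
    suc (double t) , ≤-trans i≤t (m≤n⇒m≤1+n (n≤double t)) ,
    trans (g≡f (double t)) (trans (cong f (⌈double/2⌉ t)) ft≡c)

interleave : ∀ {A : Set} → (ℕ → A) → (ℕ → A) → ℕ → A
interleave f g zero          = f 0
interleave f g (suc zero)    = g 0
interleave f g (suc (suc i)) = interleave (f ∘ suc) (g ∘ suc) i

module _ {A : Set} where

  interleave-double : ∀ (f g : ℕ → A) t → interleave f g (double t) ≡ f t
  interleave-double f g zero    = refl
  interleave-double f g (suc t) = interleave-double (f ∘ suc) (g ∘ suc) t

  interleave-suc-double : ∀ (f g : ℕ → A) t → interleave f g (suc (double t)) ≡ g t
  interleave-suc-double f g zero    = refl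
  interleave-suc-double f g (suc t) = interleave-suc-double (f ∘ suc) (g ∘ suc) t

  interleave-chain : ∀ (R : A → A → Set) {f g : ℕ → A} →
                     (∀ t → R (f t) (g t)) → (∀ t → R (g t) (f (suc t))) →
                     ∀ i → R (interleave f g i) (interleave f g (suc i))
  interleave-chain R fRg gRf zero          = fRg 0
  interleave-chain R fRg gRf (suc zero)    = gRf 0
  interleave-chain R fRg gRf (suc (suc i)) = interleave-chain R (fRg ∘ suc) (gRf ∘ suc) i

  interleave-stutter : ∀ {B : Set} (k : A → B) {f g : ℕ → A} {h : ℕ → B} →
                       (∀ t → k (f t) ≡ h t) → (∀ t → k (g t) ≡ h (suc t)) →
                       ∀ i → k (interleave f g i) ≡ h ⌈ i /2⌉
  interleave-stutter k kf≡h kg≡h zero          = kf≡h 0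
  interleave-stutter k kf≡h kg≡h (suc zero)    = kg≡h 0
  interleave-stutter k kf≡h kg≡h (suc (suc i)) = interleave-stutter k (kf≡h ∘ suc) (kg≡h ∘ suc) i

  tabulate-toℕ-∷ʳ : ∀ (p : ℕ → A) n →
                    List.tabulate {n = suc n} (p ∘ toℕ) ≡ List.tabulate {n = n} (p ∘ toℕ) ∷ʳ p n
  tabulate-toℕ-∷ʳ p zero    = refl
  tabulate-toℕ-∷ʳ p (suc n) = cong (p 0 ∷_) (tabulate-toℕ-∷ʳ (p ∘ suc) n)

zipT-++ : ∀ {a m n} (ts : Fin m → Trace a) (ts' : Fin n → Trace a) t →
          zipT (ts VF.++ ts') t ≡ zipT ts t ++ zipT ts' t
zipT-++ {m = zero}  ts ts' t = refl
zipT-++ {m = suc m} ts ts' t =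
  cong (ts Fin.zero t ∷_)
    (trans (tabulate-cong (λ j → cong (λ tr → tr t) (++-suc j))) (zipT-++ (ts ∘ Fin.suc) ts' t))
  where
  ++-suc : ∀ j → (ts VF.++ ts') (Fin.suc j) ≡ ((ts ∘ Fin.suc) VF.++ ts') j
  ++-suc j = [,]-map (splitAt m j)

module _ {a} {T : TS a} {k l : ℕ} {𝔸 : DPA (Vec (Letter a) (k + l))} where
  open TS T
  open DPA 𝔸
  open Game T k l 𝔸

  vnode-move : ∀ {ss x} → Move (vnode ss) x →
               ∃ λ es → x ≡ tnode ss es q₀ ∀♭ × All S₀ es
  vnode-move (init _ es es-initial) = es , refl , es-initial

  ∃node-move : ∀ {ss es q x} → Move (tnode ss es q ∃♭) x →
               ∃ λ es' → x ≡ tnode ss es' q ∀♭ × Pointwise ϱ es es'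
  ∃node-move (exis _ _ es' _ es-step) = es' , refl , es-step

module RefuterFollows {a} (T : TS a) (k l : ℕ) (𝔸 : DPA (Vec (Letter a) (k + l)))
                      (us : Fin k → Trace a) (us-traces : ∀ i → TS.IsTrace T (us i)) where
  open TS T
  open DPA 𝔸
  open Game T k l 𝔸

  universal : ℕ → Vec State k
  universal t = tabulate (λ i → proj₁ (us-traces i) t)

  universal-initial : All S₀ (universal 0)
  universal-initial = All.tabulate⁺ (λ i → proj₁ (proj₁ (proj₂ (us-traces i))))

  universal-step : ∀ t → Pointwise ϱ (universal t) (universal (suc t))
  universal-step t = Pointwise.tabulate⁺ (λ i → proj₂ (proj₁ (proj₂ (us-traces i))) t)

  universal-labels : ∀ t → zipT us t ≡ map L (universal t)
  universal-labels t =
    trans (tabulate-cong (λ i → proj₂ (proj₂ (us-traces i)) t)) (tabulate-∘ L (λ i → proj₁ (us-traces i) t))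

  module Against (σ : Strategy) where

    opening : Node
    opening = vnode (universal 0)

    opening-reply : Σ Node (Move opening)
    opening-reply = σ [] opening refl

    -- Round t starts at ∀node t, and past t is the history the verifier has seen before it.
    existential     : ℕ → Vec State l
    letters         : ℕ → Vec (Letter a) (k + l)
    automaton-state : ℕ → Fin nQ
    ∀node ∃node     : ℕ → Node
    past            : ℕ → List Node
    reply           : ∀ t → Σ Node (Move (∃node t))

    letters t = map L (universal t ++ existential t)

    automaton-state zero    = q₀
    automaton-state (suc t) = δ (automaton-state t) (letters t)

    ∀node t = tnode (universal t) (existential t) (automaton-state t) ∀♭
    ∃node t = tnode (universal (suc t)) (existential t) (δ (automaton-state t) (letters t)) ∃♭

    past zero    = opening ∷ []
    past (suc t) = past t ∷ʳ ∀node t ∷ʳ ∃node t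

    reply t = σ (past t ∷ʳ ∀node t) (∃node t) refl

    existential zero    = proj₁ (vnode-move (proj₂ opening-reply))
    existential (suc t) = proj₁ (∃node-move (proj₂ (reply t)))

    opening-reply≡ : proj₁ opening-reply ≡ ∀node 0
    opening-reply≡ = proj₁ (proj₂ (vnode-move (proj₂ opening-reply)))

    reply≡ : ∀ t → proj₁ (reply t) ≡ ∀node (suc t)
    reply≡ t = proj₁ (proj₂ (∃node-move (proj₂ (reply t))))

    play : ℕ → Node
    play zero    = opening
    play (suc i) = interleave ∀node ∃node i

    play-moves : ∀ i → Move (play i) (play (suc i))
    play-moves zero    = subst (Move opening) opening-reply≡ (proj₂ opening-reply)
    play-moves (suc i) = interleave-chain Move
      (λ t → univ _ _ _ _ (universal-step t))
      (λ t → subst (Move (∃node t)) (reply≡ t) (proj₂ (reply t)))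
      i

    history-play : ∀ t → history play (suc (double t)) ≡ past t
    history-play zero    = refl
    history-play (suc t) = begin
      history play (suc (suc (suc (double t))))
        ≡⟨ tabulate-toℕ-∷ʳ play (suc (suc (double t))) ⟩
      history play (suc (suc (double t))) ∷ʳ play (suc (suc (double t)))
        ≡⟨ cong (_∷ʳ play (suc (suc (double t)))) (tabulate-toℕ-∷ʳ play (suc (double t))) ⟩
      history play (suc (double t)) ∷ʳ play (suc (double t)) ∷ʳ play (suc (suc (double t)))
        ≡⟨ cong₂ _∷ʳ_ (cong₂ _∷ʳ_ (history-play t) (interleave-double ∀node ∃node t))
                      (interleave-suc-double ∀node ∃node t) ⟩
      past (suc t) ∎
      where open ≡-Reasoning

    ∀node-refuter : ∀ t {x} → x ≡ ∀node t → owner x ≡ verifier → ⊥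
    ∀node-refuter t refl ()

    ∃node-consistent : ∀ t {h x y} (o : owner x ≡ verifier) →
                       h ≡ past t ∷ʳ ∀node t → x ≡ ∃node t → y ≡ ∀node (suc t) →
                       y ≡ proj₁ (σ h x o)
    ∃node-consistent t refl refl refl refl = sym (reply≡ t)

    play-consistent : ConsistentWith σ play
    play-consistent i o with parity i
    play-consistent .0 refl | even zero = sym opening-reply≡
    play-consistent ._ o | even (suc t) =
      ∃node-consistent t o
        (trans (tabulate-toℕ-∷ʳ play (suc (double t)))
               (cong₂ _∷ʳ_ (history-play t) (interleave-double ∀node ∃node t)))
        (interleave-suc-double ∀node ∃node t)
        (interleave-double (∀node ∘ suc) (∃node ∘ suc) t)
    play-consistent ._ o | odd t = ⊥-elim (∀node-refuter t (interleave-double ∀node ∃node t) o)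

    existential-trace : Fin l → Trace a
    existential-trace j t = L (lookup (existential t) j)

    existential-initial : All S₀ (existential 0)
    existential-initial = proj₂ (proj₂ (vnode-move (proj₂ opening-reply)))

    existential-step : ∀ t → Pointwise ϱ (existential t) (existential (suc t))
    existential-step t = proj₂ (proj₂ (∃node-move (proj₂ (reply t))))

    existential-trace-valid : ∀ j → IsTrace (existential-trace j)
    existential-trace-valid j =
      (λ t → lookup (existential t) j) ,
      (All.lookup⁺ existential-initial j , λ t → Pointwise.lookup (existential-step t) j) ,
      λ _ → refl

    word : ℕ → Vec (Letter a) (k + l)
    word = zipT (us VF.++ existential-trace)

    word≡letters : ∀ t → word t ≡ letters t
    word≡letters t = begin
      zipT (us VF.++ existential-trace) t
        ≡⟨ zipT-++ us existential-trace t ⟩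
      zipT us t ++ zipT existential-trace t
        ≡⟨ cong₂ _++_ (universal-labels t) existential-labels ⟩
      map L (universal t) ++ map L (existential t)
        ≡⟨ map-++ L (universal t) (existential t) ⟨
      letters t ∎
      where
      open ≡-Reasoning
      existential-labels : zipT existential-trace t ≡ map L (existential t)
      existential-labels =
        trans (tabulate-∘ L (lookup (existential t))) (cong (map L) (tabulate∘lookup (existential t)))

    run-word : ∀ t → run word t ≡ automaton-state t
    run-word zero    = refl
    run-word (suc t) = cong₂ δ (run-word t) (word≡letters t)

    play-colour : ∀ i → colour (play (suc i)) ≡ c (run word ⌈ i /2⌉)
    play-colour = interleave-stutter colour
      (λ t → cong c (sym (run-word t)))
      (λ t → cong c (sym (run-word (suc t))))

  existential-witness : VerifierWins (vnode (universal 0)) →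
                        ∃ λ (es : Fin l → Trace a) → (∀ j → IsTrace (es j)) × Accepts (zipT (us VF.++ es))
  existential-witness (σ , σ-wins) =
    existential-trace , existential-trace-valid ,
    ParityWin-cong (λ _ → InfOften-stutter play-colour)
      (σ-wins play (refl , play-moves) play-consistent)
    where open Against σ

theorem2 : ∀ {a} (T : TS a) (k l : ℕ) (φ : LTL a (k + l))
             (𝔸 : DPA (Vec (Letter a) (k + l))) →
             (∀ (ts : Fin (k + l) → Trace a) → DPA.Accepts 𝔸 (zipT ts) ⇔ Sat φ ts 0) →
             (∀ (ss : Vec (TS.State T) k) → All (TS.S₀ T) ss →
               Game.VerifierWins T k l 𝔸 (Game.vnode ss)) →
             Models T k l φ
theorem2 T k l φ 𝔸 𝔸⇔φ verifier-wins us us-traces =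
  let es , es-traces , accepted = existential-witness (verifier-wins (universal 0) universal-initial)
  in  es , es-traces , Equivalence.to (𝔸⇔φ (us VF.++ es)) accepted
  where open RefuterFollows T k l 𝔸 us us-traces
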